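{- Let $d_0\in\{ -1,2\}$ and let $w,z\in\mathbb{Z}[\sqrt{d_0}]$ both be odd. Then $\gamma(w,z)\gamma(z,w)=\mu(wz)$.
   Context: Bar denotes the nontrivial automorphism of $\mathbb{Q}(\sqrt{d_0})$ and $\mathrm{N}$ the norm; $w$ is odd if $\mathrm{N}(w)$ is odd. For a prime ideal $\mathfrak p\nmid 2$ and $a\in\mathbb{Z}[\sqrt{d_0}]$, $\left(\frac{a}{\mathfrak p}\right)$ is $0$ if $a\in\mathfrak p$, else $\pm1$ according as $a$ is or is not a square mod $\mathfrak p$; for an odd ideal $\mathfrak a$, $\left(\frac{a}{\mathfrak a}\right)$ is the product over its prime factors with multiplicity. For odd $w$ and any $z$, $\gamma(w,z)=\left(\frac{\bar w\bar z}{(w)}\right)$ and $\mu(w)=\gamma(w,1)=\left(\frac{\bar w}{(w)}\right)$. -}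

module Defs where

open import Data.Integer as ℤ using (ℤ; +_; -_; 0ℤ; 1ℤ; -1ℤ)
open import Data.Integer.Divisibility using () renaming (_∣_ to _∣ℤ_)
open import Data.List using (List; []; _∷_)
open import Data.List.Relation.Unary.All using (All)
open import Data.Product using (Σ; ∃; ∃-syntax; _×_; _,_)
open import Data.Sum using (_⊎_)
open import Relation.Nullary using (¬_)
open import Relation.Binary.PropositionalEquality using (_≡_)

record ℤ[√_] (d : ℤ) : Set where
  constructor _+_√
  field
    re : ℤ
    im : ℤ
open ℤ[√_] public

module _ {d : ℤ} where

  0̂ : ℤ[√ d ]
  0̂ = 0ℤ + 0ℤ √

  1̂ : ℤ[√ d ]
  1̂ = 1ℤ + 0ℤ √

  infixl 6 _+̂_ _-̂_
  infixl 7 _*̂_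

  _+̂_ : ℤ[√ d ] → ℤ[√ d ] → ℤ[√ d ]
  (a + b √) +̂ (c + e √) = (a ℤ.+ c) + (b ℤ.+ e) √

  _-̂_ : ℤ[√ d ] → ℤ[√ d ] → ℤ[√ d ]
  (a + b √) -̂ (c + e √) = (a ℤ.- c) + (b ℤ.- e) √

  _*̂_ : ℤ[√ d ] → ℤ[√ d ] → ℤ[√ d ]
  (a + b √) *̂ (c + e √) = (a ℤ.* c ℤ.+ d ℤ.* b ℤ.* e) + (a ℤ.* e ℤ.+ b ℤ.* c) √

  conj : ℤ[√ d ] → ℤ[√ d ]
  conj (a + b √) = a + (ℤ.- b) √

  N : ℤ[√ d ] → ℤ
  N (a + b √) = a ℤ.* a ℤ.- d ℤ.* b ℤ.* b

  Odd : ℤ[√ d ] → Set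
  Odd w = ¬ ((+ 2) ∣ℤ N w)

  _∣_ : ℤ[√ d ] → ℤ[√ d ] → Set
  x ∣ y = ∃[ c ] (y ≡ x *̂ c)

  IsUnit : ℤ[√ d ] → Set
  IsUnit u = ∃[ v ] (u *̂ v ≡ 1̂)

  -- prime elements; ℤ[√d] is a PID for d ∈ {-1, 2}, so the nonzero prime
  -- ideals are exactly the ideals (π) with π a prime element
  IsPrime : ℤ[√ d ] → Set
  IsPrime π = ¬ (π ≡ 0̂) × ¬ IsUnit π × (∀ x y → π ∣ (x *̂ y) → (π ∣ x) ⊎ (π ∣ y))

  product : List (ℤ[√ d ]) → ℤ[√ d ]
  product []       = 1̂
  product (x ∷ xs) = x *̂ product xs

  data Legendre (π a : ℤ[√ d ]) : ℤ → Set where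
    leg-zero : π ∣ a → Legendre π a 0ℤ
    leg-sq   : ¬ (π ∣ a) → (∃[ x ] (π ∣ (x *̂ x -̂ a))) → Legendre π a 1ℤ
    leg-nsq  : ¬ (π ∣ a) → ¬ (∃[ x ] (π ∣ (x *̂ x -̂ a))) → Legendre π a -1ℤ

  data LegendreProd (a : ℤ[√ d ]) : List (ℤ[√ d ]) → ℤ → Set where
    []  : LegendreProd a [] 1ℤ
    _∷_ : ∀ {π ps s t} → Legendre π a s → LegendreProd a ps t →
          LegendreProd a (π ∷ ps) (s ℤ.* t)

  -- Jacobi symbol (a / (w)) = s: for a factorization (w) = (π₁)⋯(πₖ) of the
  -- ideal (w) into prime ideals, s = ∏ (a / (πᵢ)).
  Jacobi : ℤ[√ d ] → ℤ[√ d ] → ℤ → Set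
  Jacobi w a s = ∃[ u ] ∃[ ps ]
    (IsUnit u × All IsPrime ps × w ≡ u *̂ product ps × LegendreProd a ps s)

  γ : ℤ[√ d ] → ℤ[√ d ] → ℤ → Set
  γ w z s = Jacobi w (conj w *̂ conj z) s

  μ : ℤ[√ d ] → ℤ → Set
  μ w s = γ w 1̂ s

module Submission where

-- All three symbols are Jacobi symbols with the same numerator a = w̄z̄
-- (as z̄w̄ = w̄z̄ = conj(wz)·1), so the claim is multiplicativity in the
-- denominator, (a / (w)) (a / (z)) = (a / (wz)).  The Jacobi symbol is a
-- relation, computed from any factorisation of the denominator into a unit
-- and primes, so this splits into
--   * multiplicativity: factorisations of w and z combine into one of wz
--     (jacobi-*, valid for every d);
--   * well-definedness: two factorisations of one element give the same
--     symbol (jacobi-unique).  A prime dividing u·q₁⋯qₖ is associated to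
--     some qᵢ and the Legendre symbol depends only on the ideal, so the
--     factors can be matched one by one, cancelling as we go.
-- Cancellation holds when the norm is definite, N(p) = 0 ⇒ p = 0, which is
-- where d₀ ∈ {-1, 2} enters (for d₀ = 2 via the irrationality of √2).

open import Defs
open import Data.Integer using (ℤ; +_; -1ℤ; _*_)
open import Data.Sum using (_⊎_)
open import Relation.Binary.PropositionalEquality using (_≡_)

open import Algebra.Bundles using (CommutativeMonoid)
open import Algebra.Structures using (IsCommutativeMonoid)
open import Data.Integer as ℤ using (0ℤ; 1ℤ; ∣_∣)
import Data.Integer.Properties as ℤ
open import Data.Integer.Tactic.RingSolver using (solve-∀)
open import Data.Nat as ℕ using (ℕ; zero; suc)
import Data.Nat.Properties as ℕ
open import Data.Nat.Divisibility using (divides) renaming (_∣_ to _∣ℕ_)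
open import Data.Nat.Tactic.RingSolver using () renaming (solve-∀ to ℕ-solve-∀)
open import Function using (id)
open import Data.Nat.Induction using (<-rec)
open import Data.Nat.Primality using (euclidsLemma; prime[2])
open import Data.List using (List; []; _∷_)
open import Data.List.Relation.Unary.All using (All; []; _∷_)
open import Data.Product using (∃-syntax; _×_; _,_)
open import Data.Sum using (inj₁; inj₂; [_,_])
open import Data.Empty using (⊥-elim)
open import Level using (0ℓ)
open import Relation.Nullary using (¬_)
open import Relation.Binary.PropositionalEquality
  using (refl; sym; trans; cong; cong₂; subst; subst₂; isEquivalence; module ≡-Reasoning)

module _ {d : ℤ} where

  *̂-comm : (x y : ℤ[√ d ]) → x *̂ y ≡ y *̂ x
  *̂-comm (a + b √) (c + e √) = cong₂ _+_√ (re-eq a b c e d) (im-eq a b c e)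
    where
    re-eq : ∀ a b c e d → a ℤ.* c ℤ.+ d ℤ.* b ℤ.* e ≡ c ℤ.* a ℤ.+ d ℤ.* e ℤ.* b
    re-eq = solve-∀
    im-eq : ∀ a b c e → a ℤ.* e ℤ.+ b ℤ.* c ≡ c ℤ.* b ℤ.+ e ℤ.* a
    im-eq = solve-∀

  *̂-assoc : (x y z : ℤ[√ d ]) → (x *̂ y) *̂ z ≡ x *̂ (y *̂ z)
  *̂-assoc (a + b √) (c + e √) (f + g √) =
    cong₂ _+_√ (re-eq a b c e f g d) (im-eq a b c e f g d)
    where
    re-eq : ∀ a b c e f g d →
            (a ℤ.* c ℤ.+ d ℤ.* b ℤ.* e) ℤ.* f ℤ.+ d ℤ.* (a ℤ.* e ℤ.+ b ℤ.* c) ℤ.* g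
            ≡ a ℤ.* (c ℤ.* f ℤ.+ d ℤ.* e ℤ.* g) ℤ.+ d ℤ.* b ℤ.* (c ℤ.* g ℤ.+ e ℤ.* f)
    re-eq = solve-∀
    im-eq : ∀ a b c e f g d →
            (a ℤ.* c ℤ.+ d ℤ.* b ℤ.* e) ℤ.* g ℤ.+ (a ℤ.* e ℤ.+ b ℤ.* c) ℤ.* f
            ≡ a ℤ.* (c ℤ.* g ℤ.+ e ℤ.* f) ℤ.+ b ℤ.* (c ℤ.* f ℤ.+ d ℤ.* e ℤ.* g)
    im-eq = solve-∀

  *̂-identityʳ : (x : ℤ[√ d ]) → x *̂ 1̂ ≡ x
  *̂-identityʳ (a + b √) = cong₂ _+_√ (re-eq a b d) (im-eq a b)
    where
    re-eq : ∀ a b d → a ℤ.* 1ℤ ℤ.+ d ℤ.* b ℤ.* 0ℤ ≡ a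
    re-eq = solve-∀
    im-eq : ∀ a b → a ℤ.* 0ℤ ℤ.+ b ℤ.* 1ℤ ≡ b
    im-eq = solve-∀

  *̂-identityˡ : (x : ℤ[√ d ]) → 1̂ *̂ x ≡ x
  *̂-identityˡ x = trans (*̂-comm 1̂ x) (*̂-identityʳ x)

  conj-*̂ : (x y : ℤ[√ d ]) → conj (x *̂ y) ≡ conj x *̂ conj y
  conj-*̂ (a + b √) (c + e √) = cong₂ _+_√ (re-eq a b c e d) (im-eq a b c e)
    where
    re-eq : ∀ a b c e d → a ℤ.* c ℤ.+ d ℤ.* b ℤ.* e
                        ≡ a ℤ.* c ℤ.+ d ℤ.* (ℤ.- b) ℤ.* (ℤ.- e)
    re-eq = solve-∀
    im-eq : ∀ a b c e → ℤ.- (a ℤ.* e ℤ.+ b ℤ.* c) ≡ a ℤ.* (ℤ.- e) ℤ.+ (ℤ.- b) ℤ.* c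
    im-eq = solve-∀

  -- Multiplying by p̄p = N(p) scales both coordinates by the norm; this is
  -- what reduces cancellation in ℤ[√d] to cancellation in ℤ.
  conj-*̂-self : (p x : ℤ[√ d ]) →
                conj p *̂ (p *̂ x) ≡ (N p ℤ.* re x) + (N p ℤ.* im x) √
  conj-*̂-self (a + b √) (c + e √) = cong₂ _+_√ (re-eq a b c e d) (im-eq a b c e d)
    where
    re-eq : ∀ a b c e d →
            a ℤ.* (a ℤ.* c ℤ.+ d ℤ.* b ℤ.* e) ℤ.+ d ℤ.* (ℤ.- b) ℤ.* (a ℤ.* e ℤ.+ b ℤ.* c)
            ≡ (a ℤ.* a ℤ.- d ℤ.* b ℤ.* b) ℤ.* c
    re-eq = solve-∀
    im-eq : ∀ a b c e d →
            a ℤ.* (a ℤ.* e ℤ.+ b ℤ.* c) ℤ.+ (ℤ.- b) ℤ.* (a ℤ.* c ℤ.+ d ℤ.* b ℤ.* e)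
            ≡ (a ℤ.* a ℤ.- d ℤ.* b ℤ.* b) ℤ.* e
    im-eq = solve-∀

*̂-commutativeMonoid : ℤ → CommutativeMonoid 0ℓ 0ℓ
*̂-commutativeMonoid d = record
  { Carrier             = ℤ[√ d ]
  ; _≈_                 = _≡_
  ; _∙_                 = _*̂_
  ; ε                   = 1̂
  ; isCommutativeMonoid = isCommutativeMonoid
  }
  where
  isCommutativeMonoid : IsCommutativeMonoid _≡_ _*̂_ 1̂
  isCommutativeMonoid = record
    { isMonoid = record
      { isSemigroup = record
        { isMagma = record { isEquivalence = isEquivalence ; ∙-cong = cong₂ _*̂_ }
        ; assoc   = *̂-assoc
        }
      ; identity = *̂-identityˡ , *̂-identityʳ
      }
    ; comm = *̂-comm
    }

NormDefinite : ℤ → Set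
NormDefinite d = (p : ℤ[√ d ]) → N p ≡ 0ℤ → p ≡ 0̂

square-abs : (a : ℤ) → a ℤ.* a ≡ + (∣ a ∣ ℕ.* ∣ a ∣)
square-abs (+ n)      = ℤ.+◃n≡+n _
square-abs ℤ.-[1+ n ] = ℤ.+◃n≡+n _

square≡0 : (n : ℕ) → n ℕ.* n ≡ 0 → n ≡ 0
square≡0 zero    _ = refl
square≡0 (suc _) ()

abs≡0 : {a : ℤ} → ∣ a ∣ ℕ.* ∣ a ∣ ≡ 0 → a ≡ 0ℤ
abs≡0 {a} e = ℤ.∣i∣≡0⇒i≡0 (square≡0 ∣ a ∣ e)

normDefinite[-1] : NormDefinite -1ℤ
normDefinite[-1] (a + b √) N≡0 = cong₂ _+_√ (abs≡0 (ℕ.m+n≡0⇒m≡0 _ sum≡0))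
                                            (abs≡0 (ℕ.m+n≡0⇒n≡0 _ sum≡0))
  where
  norm-eq : ∀ a b → a ℤ.* a ℤ.- -1ℤ ℤ.* b ℤ.* b ≡ a ℤ.* a ℤ.+ b ℤ.* b
  norm-eq = solve-∀
  sum≡0 : ∣ a ∣ ℕ.* ∣ a ∣ ℕ.+ ∣ b ∣ ℕ.* ∣ b ∣ ≡ 0
  sum≡0 = cong ∣_∣ (begin
    + (∣ a ∣ ℕ.* ∣ a ∣ ℕ.+ ∣ b ∣ ℕ.* ∣ b ∣)   ≡⟨ ℤ.pos-+ (∣ a ∣ ℕ.* ∣ a ∣) _ ⟩
    + (∣ a ∣ ℕ.* ∣ a ∣) ℤ.+ + (∣ b ∣ ℕ.* ∣ b ∣) ≡⟨ sym (cong₂ ℤ._+_ (square-abs a) (square-abs b)) ⟩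
    a ℤ.* a ℤ.+ b ℤ.* b                       ≡⟨ sym (norm-eq a b) ⟩
    N { -1ℤ} (a + b √)                        ≡⟨ N≡0 ⟩
    0ℤ                                        ∎)
    where open ≡-Reasoning

even-square⇒even : (m : ℕ) → 2 ∣ℕ m ℕ.* m → 2 ∣ℕ m
even-square⇒even m 2∣m² = [ id , id ] (euclidsLemma m m prime[2] 2∣m²)

-- Irrationality of √2: m² = 2n² only for m = 0.  By descent: m is even,
-- m = 2k, so n² = 2k²; if n ≠ 0 then n < m, and the induction hypothesis
-- at n forces n = 0 after all.
√2-irrational : (m n : ℕ) → m ℕ.* m ≡ 2 ℕ.* (n ℕ.* n) → m ≡ 0
√2-irrational = <-rec (λ m → ∀ n → m ℕ.* m ≡ 2 ℕ.* (n ℕ.* n) → m ≡ 0) descent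
  where
  descent : ∀ m → (∀ {n} → n ℕ.< m → ∀ k → n ℕ.* n ≡ 2 ℕ.* (k ℕ.* k) → n ≡ 0) →
            ∀ n → m ℕ.* m ≡ 2 ℕ.* (n ℕ.* n) → m ≡ 0
  descent m ih zero eq = square≡0 m eq
  descent m ih n@(suc _) eq
    with even-square⇒even m (divides (n ℕ.* n) (trans eq (ℕ.*-comm 2 (n ℕ.* n))))
  ... | divides k refl = ⊥-elim (ℕ.1+n≢0 (ih n<m k n²≡2k²))
    where
    n²≡2k² : n ℕ.* n ≡ 2 ℕ.* (k ℕ.* k)
    n²≡2k² = ℕ.*-cancelˡ-≡ _ _ 2 (trans (sym eq) (quadruple k))
      where
      quadruple : ∀ k → (k ℕ.* 2) ℕ.* (k ℕ.* 2) ≡ 2 ℕ.* (2 ℕ.* (k ℕ.* k))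
      quadruple = ℕ-solve-∀
    -- n² < 2n² = m², hence n < m
    n<m : n ℕ.< k ℕ.* 2
    n<m = ℕ.≰⇒> λ m≤n → ℕ.<⇒≱ n²<m² (ℕ.*-mono-≤ m≤n m≤n)
      where
      n²<m² : n ℕ.* n ℕ.< (k ℕ.* 2) ℕ.* (k ℕ.* 2)
      n²<m² = subst (n ℕ.* n ℕ.<_) (sym eq) (ℕ.m<m+n (n ℕ.* n) ℕ.z<s)

normDefinite[2] : NormDefinite (+ 2)
normDefinite[2] (a + b √) N≡0 = cong₂ _+_√ (abs≡0 (cong (λ n → n ℕ.* n) ∣a∣≡0))
                                           (abs≡0 (ℕ.*-cancelˡ-≡ _ 0 2 ∣b∣²≡0))
  where
  norm-eq : ∀ a b → a ℤ.* a ≡ (a ℤ.* a ℤ.- + 2 ℤ.* b ℤ.* b) ℤ.+ + 2 ℤ.* (b ℤ.* b)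
  norm-eq = solve-∀
  squares : ∣ a ∣ ℕ.* ∣ a ∣ ≡ 2 ℕ.* (∣ b ∣ ℕ.* ∣ b ∣)
  squares = begin
    ∣ a ∣ ℕ.* ∣ a ∣                    ≡⟨ cong ∣_∣ (sym (square-abs a)) ⟩
    ∣ a ℤ.* a ∣                        ≡⟨ cong ∣_∣ (norm-eq a b) ⟩
    ∣ N {+ 2} (a + b √) ℤ.+ + 2 ℤ.* (b ℤ.* b) ∣ ≡⟨ cong (λ n → ∣ n ℤ.+ + 2 ℤ.* (b ℤ.* b) ∣) N≡0 ⟩
    ∣ 0ℤ ℤ.+ + 2 ℤ.* (b ℤ.* b) ∣       ≡⟨ cong ∣_∣ (ℤ.+-identityˡ (+ 2 ℤ.* (b ℤ.* b))) ⟩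
    ∣ + 2 ℤ.* (b ℤ.* b) ∣              ≡⟨ ℤ.abs-* (+ 2) (b ℤ.* b) ⟩
    2 ℕ.* ∣ b ℤ.* b ∣                  ≡⟨ cong (λ n → 2 ℕ.* ∣ n ∣) (square-abs b) ⟩
    2 ℕ.* (∣ b ∣ ℕ.* ∣ b ∣)            ∎
    where open ≡-Reasoning
  ∣a∣≡0 : ∣ a ∣ ≡ 0
  ∣a∣≡0 = √2-irrational ∣ a ∣ ∣ b ∣ squares
  ∣b∣²≡0 : 2 ℕ.* (∣ b ∣ ℕ.* ∣ b ∣) ≡ 2 ℕ.* 0
  ∣b∣²≡0 = trans (sym squares) (cong (λ n → n ℕ.* n) ∣a∣≡0)

module _ {d : ℤ} where

  open import Algebra.Properties.CommutativeSemigroup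
    (CommutativeMonoid.commutativeSemigroup (*̂-commutativeMonoid d))
    using (x∙yz≈y∙xz; interchange)

  -- Divisibility is transitive.  (The elements are explicit arguments:
  -- they cannot be recovered from the divisibility witnesses.)
  ∣-trans : (x y z : ℤ[√ d ]) → x ∣ y → y ∣ z → x ∣ z
  ∣-trans x _ _ (c , refl) (c' , refl) = c *̂ c' , *̂-assoc x c c'

  unit-* : {u v : ℤ[√ d ]} → IsUnit u → IsUnit v → IsUnit (u *̂ v)
  unit-* {u} {v} (u' , uu'≡1) (v' , vv'≡1) = u' *̂ v' , (begin
    (u *̂ v) *̂ (u' *̂ v') ≡⟨ interchange u v u' v' ⟩
    (u *̂ u') *̂ (v *̂ v') ≡⟨ cong₂ _*̂_ uu'≡1 vv'≡1 ⟩
    1̂ *̂ 1̂               ≡⟨ *̂-identityʳ 1̂ ⟩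
    1̂                   ∎)
    where open ≡-Reasoning

  -- Every divisor of a unit is a unit, so a prime divides no unit.
  prime-∤-unit : {p u : ℤ[√ d ]} → IsPrime p → IsUnit u → ¬ p ∣ u
  prime-∤-unit {p} (_ , p-nonunit , _) (v , uv≡1) (c , refl) =
    p-nonunit (c *̂ v , trans (sym (*̂-assoc p c v)) uv≡1)

  legendre-resp-ideal : {p q a : ℤ[√ d ]} {s : ℤ} → p ∣ q → q ∣ p →
                        Legendre q a s → Legendre p a s
  legendre-resp-ideal {p} {q} {a} p∣q q∣p (leg-zero q∣a) = leg-zero (∣-trans p q a p∣q q∣a)
  legendre-resp-ideal {p} {q} {a} p∣q q∣p (leg-sq q∤a (x , q∣x²-a)) =
    leg-sq (λ p∣a → q∤a (∣-trans q p a q∣p p∣a)) (x , ∣-trans p q _ p∣q q∣x²-a)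
  legendre-resp-ideal {p} {q} {a} p∣q q∣p (leg-nsq q∤a q-nonsq) =
    leg-nsq (λ p∣a → q∤a (∣-trans q p a q∣p p∣a))
            (λ { (x , p∣x²-a) → q-nonsq (x , ∣-trans q p _ q∣p p∣x²-a) })

  legendre-functional : {p a : ℤ[√ d ]} {s t : ℤ} → Legendre p a s → Legendre p a t → s ≡ t
  legendre-functional (leg-zero _)       (leg-zero _)       = refl
  legendre-functional (leg-sq _ _)       (leg-sq _ _)       = refl
  legendre-functional (leg-nsq _ _)      (leg-nsq _ _)      = refl
  legendre-functional (leg-zero p∣a)     (leg-sq p∤a _)     = ⊥-elim (p∤a p∣a)
  legendre-functional (leg-zero p∣a)     (leg-nsq p∤a _)    = ⊥-elim (p∤a p∣a)
  legendre-functional (leg-sq p∤a _)     (leg-zero p∣a)     = ⊥-elim (p∤a p∣a)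
  legendre-functional (leg-nsq p∤a _)    (leg-zero p∣a)     = ⊥-elim (p∤a p∣a)
  legendre-functional (leg-sq _ sq)      (leg-nsq _ nonsq)  = ⊥-elim (nonsq sq)
  legendre-functional (leg-nsq _ nonsq)  (leg-sq _ sq)      = ⊥-elim (nonsq sq)

  jacobi-cons : {q m a : ℤ[√ d ]} {s t : ℤ} → IsPrime q → Legendre q a s →
                Jacobi m a t → Jacobi (q *̂ m) a (s * t)
  jacobi-cons {q} q-prime lq (u , ps , u-unit , ps-prime , refl , lps) =
    u , q ∷ ps , u-unit , q-prime ∷ ps-prime , x∙yz≈y∙xz q u (product ps) , lq ∷ lps

  jacobi-unit : {u m a : ℤ[√ d ]} {t : ℤ} → IsUnit u → Jacobi m a t → Jacobi (u *̂ m) a t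
  jacobi-unit {u} u-unit (v , ps , v-unit , ps-prime , refl , lps) =
    u *̂ v , ps , unit-* {u} {v} u-unit v-unit , ps-prime , sym (*̂-assoc u v (product ps)) , lps

  jacobi-* : {w z a : ℤ[√ d ]} {s t : ℤ} → Jacobi w a s → Jacobi z a t → Jacobi (w *̂ z) a (s * t)
  jacobi-* {z = z} {t = t} (u , [] , u-unit , [] , refl , []) Jz =
    subst₂ (λ m → Jacobi m _) (cong (_*̂ z) (sym (*̂-identityʳ u))) (sym (ℤ.*-identityˡ t))
           (jacobi-unit {u} u-unit Jz)
  jacobi-* {z = z} {t = t}
           (u , p ∷ ps , u-unit , p-prime ∷ ps-prime , refl , _∷_ {s = s} {t = s'} lp lps) Jz =
    subst₂ (λ m → Jacobi m _) (reassoc u p (product ps) z) (sym (ℤ.*-assoc s s' t))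
           (jacobi-cons {p} p-prime lp (jacobi-* (u , ps , u-unit , ps-prime , refl , lps) Jz))
    where
    reassoc : ∀ u p P z → p *̂ ((u *̂ P) *̂ z) ≡ (u *̂ (p *̂ P)) *̂ z
    reassoc u p P z = begin
      p *̂ ((u *̂ P) *̂ z) ≡⟨ sym (*̂-assoc p (u *̂ P) z) ⟩
      (p *̂ (u *̂ P)) *̂ z ≡⟨ cong (_*̂ z) (x∙yz≈y∙xz p u P) ⟩
      (u *̂ (p *̂ P)) *̂ z ∎
      where open ≡-Reasoning

module UniqueFactorisation {d : ℤ} (definite : NormDefinite d) where

  open import Algebra.Properties.CommutativeSemigroup
    (CommutativeMonoid.commutativeSemigroup (*̂-commutativeMonoid d))
    using (x∙yz≈y∙xz)

  -- Nonzero elements are cancellable: multiply by p̄ and cancel N(p) ≠ 0.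
  *̂-cancelˡ : {p : ℤ[√ d ]} (x y : ℤ[√ d ]) → ¬ p ≡ 0̂ → p *̂ x ≡ p *̂ y → x ≡ y
  *̂-cancelˡ {p} (a + b √) (c + e √) p≢0 px≡py =
    cong₂ _+_√ (ℤ.*-cancelˡ-≡ (N p) a c (cong re scaled))
               (ℤ.*-cancelˡ-≡ (N p) b e (cong im scaled))
    where
    instance
      N≢0 : ℤ.NonZero (N p)
      N≢0 = ℤ.≢-nonZero (λ N≡0 → p≢0 (definite p N≡0))
    scaled : (N p ℤ.* a) + (N p ℤ.* b) √ ≡ (N p ℤ.* c) + (N p ℤ.* e) √
    scaled = trans (sym (conj-*̂-self p (a + b √)))
                   (trans (cong (conj p *̂_) px≡py) (conj-*̂-self p (c + e √)))

  absorbs⇒one : {p c : ℤ[√ d ]} → ¬ p ≡ 0̂ → p ≡ p *̂ c → c ≡ 1̂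
  absorbs⇒one {p} {c} p≢0 p≡pc = sym (*̂-cancelˡ 1̂ c p≢0 (trans (*̂-identityʳ p) p≡pc))

  -- Since q ∣ p·c, either p = q f, and then
  -- q = q (f c) gives f c = 1; or c = q e, and then q = q (p e) makes p a unit.
  prime⇒irreducible : {q p c : ℤ[√ d ]} → IsPrime q → q ≡ p *̂ c → ¬ IsUnit p → IsUnit c
  prime⇒irreducible {q} {p} {c} (q≢0 , _ , q-prime) q≡pc p-nonunit
    with q-prime p c (1̂ , trans (sym q≡pc) (sym (*̂-identityʳ q)))
  ... | inj₁ (f , p≡qf) =
    f , trans (*̂-comm c f)
              (absorbs⇒one q≢0 (trans q≡pc (trans (cong (_*̂ c) p≡qf) (*̂-assoc q f c))))
  ... | inj₂ (e , c≡qe) =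
    ⊥-elim (p-nonunit (e , absorbs⇒one q≢0 (trans q≡pc (trans (cong (p *̂_) c≡qe) (x∙yz≈y∙xz p q e)))))

  unit-multiple-∣ : {p q c : ℤ[√ d ]} → IsUnit c → q ≡ p *̂ c → q ∣ p
  unit-multiple-∣ {p} {q} {c} (c' , cc'≡1) q≡pc = c' , (begin
    p              ≡⟨ sym (*̂-identityʳ p) ⟩
    p *̂ 1̂          ≡⟨ cong (p *̂_) (sym cc'≡1) ⟩
    p *̂ (c *̂ c')   ≡⟨ sym (*̂-assoc p c c') ⟩
    (p *̂ c) *̂ c'   ≡⟨ cong (_*̂ c') (sym q≡pc) ⟩
    q *̂ c'         ∎)
    where open ≡-Reasoning

  -- Removing a prime factor: if p·m = v·q₁⋯qₖ (v a unit, qᵢ prime), then p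
  -- is associated to some qᵢ, and the remaining factors form a
  -- factorisation of m whose symbol accounts for the rest of t.
  factor-out : {p m v a : ℤ[√ d ]} {qs : List (ℤ[√ d ])} {t : ℤ} →
               IsPrime p → IsUnit v → All IsPrime qs → LegendreProd a qs t →
               p *̂ m ≡ v *̂ product qs →
               ∃[ σ ] ∃[ t' ] (Legendre p a σ × Jacobi m a t' × t ≡ σ * t')
  factor-out {p} {m} {v} p-prime v-unit [] [] pm≡v =
    ⊥-elim (prime-∤-unit p-prime (subst IsUnit (sym (*̂-identityʳ v)) v-unit) (m , sym pm≡v))
  factor-out {p} {m} {v} {qs = q ∷ qs} p-prime@(p≢0 , p-nonunit , p-primality) v-unit
             (q-prime ∷ qs-prime) (_∷_ {s = s} {t = t₀} lq lqs) pm≡vqQ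
    with p-primality q (v *̂ Q) (m , trans (x∙yz≈y∙xz q v Q) (sym pm≡vqQ))
    where Q = product qs
  ... | inj₁ (c , q≡pc) =
    -- q = p c with c a unit: the symbol at q is the symbol at p, and m = c·v·Q
    s , t₀ , legendre-resp-ideal (c , q≡pc) (unit-multiple-∣ c-unit q≡pc) lq ,
    subst (λ x → Jacobi x _ t₀) (sym m≡cvQ)
          (jacobi-unit {u = c} c-unit (v , qs , v-unit , qs-prime , refl , lqs)) , refl
    where
    c-unit : IsUnit c
    c-unit = prime⇒irreducible {p = p} {c = c} q-prime q≡pc p-nonunit
    m≡cvQ : m ≡ c *̂ (v *̂ product qs)
    m≡cvQ = *̂-cancelˡ m (c *̂ (v *̂ product qs)) p≢0 (begin
      p *̂ m                          ≡⟨ pm≡vqQ ⟩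
      v *̂ (q *̂ product qs)           ≡⟨ x∙yz≈y∙xz v q (product qs) ⟩
      q *̂ (v *̂ product qs)           ≡⟨ cong (_*̂ (v *̂ product qs)) q≡pc ⟩
      (p *̂ c) *̂ (v *̂ product qs)     ≡⟨ *̂-assoc p c (v *̂ product qs) ⟩
      p *̂ (c *̂ (v *̂ product qs))     ∎)
      where open ≡-Reasoning
  ... | inj₂ (k , vQ≡pk)
    with factor-out {m = k} {v = v} p-prime v-unit qs-prime lqs (sym vQ≡pk)
  ... | σ , t' , lp , Jk , t₀≡σt' =
    -- p divides the rest v·Q = p k: then m = q k, and q stays in the factorisation
    σ , s * t' , lp ,
    subst (λ x → Jacobi x _ (s * t')) (sym m≡qk) (jacobi-cons {q = q} q-prime lq Jk) ,
    trans (cong (s *_) t₀≡σt') (*-swap s σ t')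
    where
    *-swap : ∀ a b c → a * (b * c) ≡ b * (a * c)
    *-swap = solve-∀
    m≡qk : m ≡ q *̂ k
    m≡qk = *̂-cancelˡ m (q *̂ k) p≢0 (begin
      p *̂ m                  ≡⟨ pm≡vqQ ⟩
      v *̂ (q *̂ product qs)   ≡⟨ x∙yz≈y∙xz v q (product qs) ⟩
      q *̂ (v *̂ product qs)   ≡⟨ cong (q *̂_) vQ≡pk ⟩
      q *̂ (p *̂ k)            ≡⟨ x∙yz≈y∙xz q p k ⟩
      p *̂ (q *̂ k)            ∎)
      where open ≡-Reasoning

  -- Peel the primes pᵢ
  -- off the other factorisation one at a time with factor-out.
  factorisation-unique : {m u a : ℤ[√ d ]} {ps : List (ℤ[√ d ])} {s t : ℤ} →
                         IsUnit u → All IsPrime ps → LegendreProd a ps s →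
                         m ≡ u *̂ product ps → Jacobi m a t → s ≡ t
  factorisation-unique _ [] [] _ (_ , [] , _ , [] , _ , []) = refl
  factorisation-unique {u = u} u-unit [] [] refl
                       (v , q ∷ qs , _ , q-prime ∷ _ , u≡vqQ , _ ∷ _) =
    ⊥-elim (prime-∤-unit q-prime (subst IsUnit (sym (*̂-identityʳ u)) u-unit)
                         (v *̂ product qs , trans u≡vqQ (x∙yz≈y∙xz v q (product qs))))
  factorisation-unique {u = u} {ps = p ∷ ps} u-unit (p-prime ∷ ps-prime) (lp ∷ lps) refl
                       (v , qs , v-unit , qs-prime , m≡vQ , lqs)
    with factor-out {m = u *̂ product ps} {v = v} p-prime v-unit qs-prime lqs
                    (trans (x∙yz≈y∙xz p u (product ps)) m≡vQ)
  ... | σ , t' , lp' , Jm' , t≡σt' =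
    trans (cong₂ _*_ (legendre-functional lp lp')
                     (factorisation-unique {u = u} u-unit ps-prime lps refl Jm'))
          (sym t≡σt')

  jacobi-unique : {m a : ℤ[√ d ]} {s t : ℤ} → Jacobi m a s → Jacobi m a t → s ≡ t
  jacobi-unique (u , ps , u-unit , ps-prime , m≡uP , lps) =
    factorisation-unique {u = u} u-unit ps-prime lps m≡uP

  -- The product formula for definite d: all three symbols have numerator
  -- w̄z̄, so it is multiplicativity plus well-definedness.
  γ-product : {w z : ℤ[√ d ]} {s t r : ℤ} → γ w z s → γ z w t → μ (w *̂ z) r → s * t ≡ r
  γ-product {w} {z} {t = t} {r} γwz γzw μwz = jacobi-unique (jacobi-* γwz γzw′) μwz′
    where
    γzw′ : Jacobi z (conj w *̂ conj z) t
    γzw′ = subst (λ a → Jacobi z a t) (*̂-comm (conj z) (conj w)) γzw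
    μwz′ : Jacobi (w *̂ z) (conj w *̂ conj z) r
    μwz′ = subst (λ a → Jacobi (w *̂ z) a r)
                 (trans (*̂-identityʳ (conj (w *̂ z))) (conj-*̂ w z)) μwz

lemma4p3 : (d₀ : ℤ) → (d₀ ≡ -1ℤ ⊎ d₀ ≡ + 2) →
           (w z : ℤ[√ d₀ ]) → Odd w → Odd z →
           ∀ {s t r} → γ w z s → γ z w t → μ (w *̂ z) r →
           s * t ≡ r
lemma4p3 .-1ℤ    (inj₁ refl) _ _ _ _ = UniqueFactorisation.γ-product normDefinite[-1]
lemma4p3 .(+ 2)  (inj₂ refl) _ _ _ _ = UniqueFactorisation.γ-product normDefinite[2]
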